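{- For any graph $G$ without isolated vertices, $sp(G)\le \Delta(G)-\delta(G)+2$.
   Context: Graphs are finite, undirected, without loops, possibly with multiple edges. $\Delta(G)$ and $\delta(G)$ are the maximum and minimum degrees. For a graph $G$ without isolated vertices, $sp(G)$ is the least integer $k$ such that $G$ has a subgraph $H$ with $V(H)=V(G)$ and $1\le d_H(x)\le k$ for all vertices $x$. -}

module Defs where

open import Data.Nat using (ℕ; zero; suc; _+_; _⊔_; _⊓_)
open import Data.Fin using (Fin; zero; suc)
open import Data.Fin.Properties using (_≟_)
open import Data.Bool using (Bool; true; false; if_then_else_)
open import Data.Product using (_×_; proj₁; proj₂)
open import Data.Sum using (_⊎_)
open import Relation.Nullary using (¬_; Dec; yes; no)
open import Relation.Binary.PropositionalEquality using (_≡_)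

-- A finite multigraph without loops: vertex set Fin n, edges indexed by Fin m,
-- each edge has two (distinct) endpoints. Parallel edges allowed.
record Graph : Set where
  field
    n     : ℕ
    m     : ℕ
    ends  : Fin m → Fin n × Fin n
    loopless : (e : Fin m) → ¬ (proj₁ (ends e) ≡ proj₂ (ends e))
open Graph public

ΣFin : (k : ℕ) → (Fin k → ℕ) → ℕ
ΣFin zero    f = 0
ΣFin (suc k) f = f zero + ΣFin k (λ i → f (suc i))

incident? : (G : Graph) → Fin (m G) → Fin (n G) → Bool
incident? G e x with proj₁ (ends G e) ≟ x | proj₂ (ends G e) ≟ x
... | yes _ | _     = true
... | no _  | yes _ = true
... | no _  | no _  = false

-- A spanning subgraph of G is given by the subset of edges it keeps
-- (vertex set is V(G)).
SpanningSubgraph : Graph → Set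
SpanningSubgraph G = Fin (m G) → Bool

degIn : (G : Graph) → SpanningSubgraph G → Fin (n G) → ℕ
degIn G H x = ΣFin (m G) (λ e → if H e then (if incident? G e x then 1 else 0) else 0)

deg : (G : Graph) → Fin (n G) → ℕ
deg G = degIn G (λ _ → true)

-- max / min over Fin k (min over empty set taken as 0; irrelevant when k ≥ 1)
maxFin : (k : ℕ) → (Fin k → ℕ) → ℕ
maxFin zero    f = 0
maxFin (suc k) f = f zero ⊔ maxFin k (λ i → f (suc i))

minFin : (k : ℕ) → (Fin k → ℕ) → ℕ
minFin zero          f = 0
minFin (suc zero)    f = f zero
minFin (suc (suc k)) f = f zero ⊓ minFin (suc k) (λ i → f (suc i))

maxDeg : Graph → ℕ
maxDeg G = maxFin (n G) (deg G)

minDeg : Graph → ℕ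
minDeg G = minFin (n G) (deg G)

NoIsolatedVertices : Graph → Set
NoIsolatedVertices G = (x : Fin (n G)) → 1 Data.Nat.≤ deg G x

-- "sp(G) ≤ k": G has a spanning subgraph H with 1 ≤ d_H(x) ≤ k for all x.
-- (sp(G) is the least such k, so sp(G) ≤ k iff such an H exists.)
SpAtMost : Graph → ℕ → Set
SpAtMost G k = Data.Product.Σ (SpanningSubgraph G) λ H →
  (x : Fin (n G)) → (1 Data.Nat.≤ degIn G H x) × (degIn G H x Data.Nat.≤ k)

-- Let c = Δ - δ + 1.  Let every vertex y choose an incident edge, thereby
-- pointing at its other endpoint.  The chosen edges form a spanning subgraph in
-- which every vertex x has degree at least 1 (its own edge) and at most
-- 1 + load(x), where load(x) counts the vertices pointing at x.  So it suffices
-- to find a choice in which every load is at most c.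
--
-- We find it by local search on the excess Σₓ (load(x) ∸ c).  If u is
-- overloaded, let R be the set of vertices reached from u by alternating walks
-- (from v to a vertex y pointing at v, then along any edge at y).  R is closed,
-- and double counting edge-ends gives δ·load(R) ≤ Δ·|R|; since Δ ≤ δ·c this
-- forces some z ∈ R with load(z) < c.  Redirecting pointers backwards along a
-- walk from u to z lowers the excess.
module Submission where

open import Defs
open import Data.Nat using (_+_; _∸_)
open import Data.Nat using (ℕ; zero; suc; _≤_; _<_; z≤n; s≤s; _*_; _<?_)
open import Data.Nat.Properties hiding (_≟_; suc-injective)
open import Data.Nat.Properties using () renaming (_≟_ to _≟ℕ_)
open import Data.Nat.Induction using (<-rec)
open import Data.Fin using (Fin; zero; suc)
open import Data.Fin.Properties using (_≟_; any?; suc-injective)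
open import Data.Bool using (Bool; true; false; if_then_else_; _∨_)
import Data.Bool as Bool
open import Data.Product using (Σ; _×_; _,_; proj₁; proj₂; ∃)
open import Data.Sum using (_⊎_; inj₁; inj₂)
open import Data.Empty using (⊥-elim)
open import Relation.Nullary using (¬_; Dec; yes; no; does)
open import Relation.Nullary.Decidable using (_×-dec_; _⊎-dec_; dec-true; dec-false)
open import Relation.Binary.PropositionalEquality hiding ([_])
open import Relation.Binary using (tri<; tri≈; tri>)
import Algebra.Properties.CommutativeMonoid.Sum as MonoidSum
import Algebra.Properties.Semiring.Sum as SemiringSum

fromDoes : ∀ {p} {P : Set p} (d : Dec P) → does d ≡ true → P
fromDoes (yes p) _  = p
fromDoes (no _)  ()

[_] : Bool → ℕ
[ b ] = if b then 1 else 0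

_==_ : ∀ {k} → Fin k → Fin k → Bool
a == b = does (a ≟ b)

==-refl : ∀ {k} (a : Fin k) → (a == a) ≡ true
==-refl a = dec-true (a ≟ a) refl

==-sym : ∀ {k} (a b : Fin k) → (a == b) ≡ (b == a)
==-sym a b with a ≟ b
... | yes refl = sym (==-refl a)
... | no a≢b = sym (dec-false (b ≟ a) (λ b≡a → a≢b (sym b≡a)))

-- Finite sums ΣFin: the library's Σ over the commutative monoid (ℕ,+,0)
-- is the same function, which lets us import its algebraic laws.
module ℕSum = MonoidSum +-0-commutativeMonoid

ΣFin≡sum : ∀ k (f : Fin k → ℕ) → ΣFin k f ≡ ℕSum.sum f
ΣFin≡sum zero    f = refl
ΣFin≡sum (suc k) f = cong (f zero +_) (ΣFin≡sum k (λ i → f (suc i)))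

Σ-cong : ∀ k {g h : Fin k → ℕ} → (∀ i → g i ≡ h i) → ΣFin k g ≡ ΣFin k h
Σ-cong zero    g≗h = refl
Σ-cong (suc k) g≗h = cong₂ _+_ (g≗h zero) (Σ-cong k (λ i → g≗h (suc i)))

Σ-+ : ∀ k (g h : Fin k → ℕ) → ΣFin k (λ i → g i + h i) ≡ ΣFin k g + ΣFin k h
Σ-+ k g h = begin
  ΣFin k (λ i → g i + h i)    ≡⟨ ΣFin≡sum k _ ⟩
  ℕSum.sum (λ i → g i + h i)  ≡⟨ ℕSum.∑-distrib-+ g h ⟩
  ℕSum.sum g + ℕSum.sum h     ≡⟨ sym (cong₂ _+_ (ΣFin≡sum k g) (ΣFin≡sum k h)) ⟩
  ΣFin k g + ΣFin k h         ∎
  where open ≡-Reasoning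

Σ-swap : ∀ k l (g : Fin k → Fin l → ℕ) →
         ΣFin k (λ i → ΣFin l (g i)) ≡ ΣFin l (λ j → ΣFin k (λ i → g i j))
Σ-swap k l g = begin
  ΣFin k (λ i → ΣFin l (g i))                   ≡⟨ Σ-cong k (λ i → ΣFin≡sum l (g i)) ⟩
  ΣFin k (λ i → ℕSum.sum (g i))                 ≡⟨ ΣFin≡sum k _ ⟩
  ℕSum.sum (λ i → ℕSum.sum (g i))               ≡⟨ ℕSum.∑-comm g ⟩
  ℕSum.sum (λ j → ℕSum.sum (λ i → g i j))       ≡⟨ sym (ΣFin≡sum l _) ⟩
  ΣFin l (λ j → ℕSum.sum (λ i → g i j))         ≡⟨ sym (Σ-cong l (λ j → ΣFin≡sum k (λ i → g i j))) ⟩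
  ΣFin l (λ j → ΣFin k (λ i → g i j))           ∎
  where open ≡-Reasoning

Σ-scale : ∀ k a (g : Fin k → ℕ) → ΣFin k (λ i → a * g i) ≡ a * ΣFin k g
Σ-scale k a g = begin
  ΣFin k (λ i → a * g i)      ≡⟨ ΣFin≡sum k _ ⟩
  ℕSum.sum (λ i → a * g i)    ≡⟨ sym (SemiringSum.*-distribˡ-sum +-*-semiring a g) ⟩
  a * ℕSum.sum g              ≡⟨ cong (a *_) (sym (ΣFin≡sum k g)) ⟩
  a * ΣFin k g                ∎
  where open ≡-Reasoning

Σ-zero : ∀ k → ΣFin k (λ _ → 0) ≡ 0
Σ-zero zero    = refl
Σ-zero (suc k) = Σ-zero k

Σ-if : ∀ k (b : Bool) (g : Fin k → ℕ) →
       (if b then ΣFin k g else 0) ≡ ΣFin k (λ i → if b then g i else 0)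
Σ-if k true  g = refl
Σ-if k false g = sym (Σ-zero k)

Σ-select : ∀ k (j : Fin k) (g : Fin k → ℕ) → ΣFin k (λ i → if j == i then g i else 0) ≡ g j
Σ-select (suc k) zero    g = trans (cong (g zero +_) (Σ-zero k)) (+-identityʳ (g zero))
Σ-select (suc k) (suc j) g = Σ-select k j (λ i → g (suc i))

Σ-count≤ : ∀ k (P : Fin k → Bool) → ΣFin k (λ i → [ P i ]) ≤ k
Σ-count≤ zero    P = z≤n
Σ-count≤ (suc k) P with P zero
... | true  = s≤s (Σ-count≤ k (λ i → P (suc i)))
... | false = m≤n⇒m≤1+n (Σ-count≤ k (λ i → P (suc i)))

Σ-mono : ∀ k {g h : Fin k → ℕ} → (∀ i → g i ≤ h i) → ΣFin k g ≤ ΣFin k h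
Σ-mono zero    g≤h = z≤n
Σ-mono (suc k) g≤h = +-mono-≤ (g≤h zero) (Σ-mono k (λ i → g≤h (suc i)))

Σ-strict : ∀ k {g h : Fin k → ℕ} → (∀ i → g i ≤ h i) → (j : Fin k) → g j < h j →
           ΣFin k g < ΣFin k h
Σ-strict (suc k) g≤h zero    gj<hj = +-mono-<-≤ gj<hj (Σ-mono k (λ i → g≤h (suc i)))
Σ-strict (suc k) g≤h (suc j) gj<hj = +-mono-≤-< (g≤h zero) (Σ-strict k (λ i → g≤h (suc i)) j gj<hj)

Σ-term : ∀ k (g : Fin k → ℕ) (j : Fin k) → g j ≤ ΣFin k g
Σ-term (suc k) g zero    = m≤m+n (g zero) _
Σ-term (suc k) g (suc j) = ≤-trans (Σ-term k (λ i → g (suc i)) j) (m≤n+m _ (g zero))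

Σ-pos : ∀ k (g : Fin k → ℕ) → 0 < ΣFin k g → ∃ λ j → 0 < g j
Σ-pos (suc k) g pos with g zero in eq
... | suc _ = zero , subst (0 <_) (sym eq) (s≤s z≤n)
... | zero  = let (j , gj>0) = Σ-pos k (λ i → g (suc i)) pos in suc j , gj>0

Σ-update : ∀ k (g g' : Fin k → ℕ) (y : Fin k) → (∀ i → i ≢ y → g' i ≡ g i) →
           ΣFin k g' + g y ≡ ΣFin k g + g' y
Σ-update (suc k) g g' zero same = begin
    (g' zero + S') + g zero  ≡⟨ cong (λ x → (g' zero + x) + g zero) S'≡S ⟩
    (g' zero + S) + g zero   ≡⟨ +-assoc (g' zero) S (g zero) ⟩
    g' zero + (S + g zero)   ≡⟨ +-comm (g' zero) (S + g zero) ⟩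
    (S + g zero) + g' zero   ≡⟨ cong (_+ g' zero) (+-comm S (g zero)) ⟩
    (g zero + S) + g' zero   ∎
  where
  open ≡-Reasoning
  S S' : ℕ
  S  = ΣFin k (λ i → g (suc i))
  S' = ΣFin k (λ i → g' (suc i))
  S'≡S : S' ≡ S
  S'≡S = Σ-cong k (λ i → same (suc i) (λ ()))
Σ-update (suc k) g g' (suc y) same = begin
    (g' zero + S') + g (suc y)  ≡⟨ +-assoc (g' zero) S' (g (suc y)) ⟩
    g' zero + (S' + g (suc y))  ≡⟨ cong₂ _+_ (same zero (λ ())) tail-update ⟩
    g zero + (S + g' (suc y))   ≡⟨ sym (+-assoc (g zero) S (g' (suc y))) ⟩
    (g zero + S) + g' (suc y)   ∎
  where
  open ≡-Reasoning
  S S' : ℕ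
  S  = ΣFin k (λ i → g (suc i))
  S' = ΣFin k (λ i → g' (suc i))
  tail-update : S' + g (suc y) ≡ S + g' (suc y)
  tail-update = Σ-update k (λ i → g (suc i)) (λ i → g' (suc i)) y
                  (λ i i≢y → same (suc i) (λ eq → i≢y (suc-injective eq)))

[]-mono : (b d : Bool) → (b ≡ true → d ≡ true) → [ b ] ≤ [ d ]
[]-mono true  d b⇒d rewrite b⇒d refl = ≤-refl
[]-mono false d b⇒d = z≤n

guard-mono : ∀ b {x y} → x ≤ y → (if b then x else 0) ≤ (if b then y else 0)
guard-mono true  x≤y = x≤y
guard-mono false x≤y = z≤n

maxFin-ub : ∀ k (f : Fin k → ℕ) (i : Fin k) → f i ≤ maxFin k f
maxFin-ub (suc k) f zero    = m≤m⊔n _ _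
maxFin-ub (suc k) f (suc i) = ≤-trans (maxFin-ub k (λ j → f (suc j)) i) (m≤n⊔m _ _)

minFin-lb : ∀ k (f : Fin k → ℕ) (i : Fin k) → minFin k f ≤ f i
minFin-lb (suc zero)    f zero    = ≤-refl
minFin-lb (suc (suc k)) f zero    = m⊓n≤m _ _
minFin-lb (suc (suc k)) f (suc i) = ≤-trans (m⊓n≤n _ _) (minFin-lb (suc k) (λ j → f (suc j)) i)

minFin-glb : ∀ k (f : Fin k → ℕ) a → Fin k → (∀ i → a ≤ f i) → a ≤ minFin k f
minFin-glb (suc zero)    f a _ a≤f = a≤f zero
minFin-glb (suc (suc k)) f a _ a≤f =
  ⊓-glb (a≤f zero) (minFin-glb (suc k) (λ j → f (suc j)) a zero (λ i → a≤f (suc i)))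

-- Arithmetic core of the counting argument: for 1 ≤ δ ≤ Δ and c = Δ - δ + 1 we
-- have Δ ≤ δ·c, hence Δ·r < δ·(c·r + 1) for every r.
capacity-bound : ∀ δ Δ r → 1 ≤ δ → δ ≤ Δ → Δ * r < δ * ((Δ ∸ δ + 1) * r + 1)
capacity-bound δ Δ r 1≤δ δ≤Δ = begin-strict
    Δ * r                  <⟨ m<m+n (Δ * r) 1≤δ ⟩
    Δ * r + δ              ≤⟨ +-monoˡ-≤ δ (*-monoˡ-≤ r Δ≤δc) ⟩
    δ * c * r + δ          ≡⟨ cong₂ _+_ (*-assoc δ c r) (sym (*-identityʳ δ)) ⟩
    δ * (c * r) + δ * 1    ≡⟨ sym (*-distribˡ-+ δ (c * r) 1) ⟩
    δ * (c * r + 1)        ∎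
  where
  open ≤-Reasoning
  c : ℕ
  c = Δ ∸ δ + 1
  Δ≤δc : Δ ≤ δ * c
  Δ≤δc = begin
    Δ                      ≡⟨ sym (m∸n+n≡m δ≤Δ) ⟩
    (Δ ∸ δ) + δ            ≤⟨ +-monoˡ-≤ δ (≤-trans (≤-reflexive (sym (*-identityˡ (Δ ∸ δ)))) (*-monoˡ-≤ (Δ ∸ δ) 1≤δ)) ⟩
    δ * (Δ ∸ δ) + δ        ≡⟨ cong (δ * (Δ ∸ δ) +_) (sym (*-identityʳ δ)) ⟩
    δ * (Δ ∸ δ) + δ * 1    ≡⟨ sym (*-distribˡ-+ δ (Δ ∸ δ) 1) ⟩
    δ * c                  ∎

descend : ∀ {a p} {A : Set a} (P : A → Set p) (μ : A → ℕ) →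
          (∀ x → P x ⊎ Σ A (λ x' → μ x' < μ x)) → A → Σ A P
descend {A = A} P μ step x₀ = <-rec Goal go (μ x₀) x₀ refl
  where
  Goal : ℕ → Set _
  Goal k = ∀ x → μ x ≡ k → Σ A P
  go : ∀ k → (∀ {j} → j < k → Goal j) → Goal k
  go k rec x refl with step x
  ... | inj₁ px         = x , px
  ... | inj₂ (x' , lt)  = rec lt x' refl

module Choices (G : Graph) where

  V : Set
  V = Fin (n G)

  E : Set
  E = Fin (m G)

  N : ℕ
  N = n G

  M : ℕ
  M = m G

  ea eb : E → V
  ea e = proj₁ (ends G e)
  eb e = proj₂ (ends G e)

  Joins : E → V → V → Set
  Joins e y z = (ea e ≡ y × eb e ≡ z) ⊎ (ea e ≡ z × eb e ≡ y)

  incident-sound : ∀ e x → incident? G e x ≡ true → ea e ≡ x ⊎ eb e ≡ x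
  incident-sound e x inc with ea e ≟ x | eb e ≟ x
  ... | yes a≡x | _       = inj₁ a≡x
  ... | no _    | yes b≡x = inj₂ b≡x

  incident-complete : ∀ e x → ea e ≡ x ⊎ eb e ≡ x → incident? G e x ≡ true
  incident-complete e x end with ea e ≟ x | eb e ≟ x | end
  ... | yes _ | _     | _          = refl
  ... | no _  | yes _ | _          = refl
  ... | no a≢x | no _  | inj₁ a≡x  = ⊥-elim (a≢x a≡x)
  ... | no _  | no b≢x | inj₂ b≡x  = ⊥-elim (b≢x b≡x)

  -- Since G has no loops, a guarded incidence indicator splits over the two endpoints.
  incidence-split : (P : V → Bool) (e : E) (w : V) →
    (if P w then [ incident? G e w ] else 0) ≡
    (if ea e == w then [ P w ] else 0) + (if eb e == w then [ P w ] else 0)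
  incidence-split P e w with ea e ≟ w | eb e ≟ w | P w
  ... | yes a≡w | yes b≡w | _     = ⊥-elim (loopless G e (trans a≡w (sym b≡w)))
  ... | yes _   | no _    | true  = refl
  ... | yes _   | no _    | false = refl
  ... | no _    | yes _   | true  = refl
  ... | no _    | yes _   | false = refl
  ... | no _    | no _    | true  = refl
  ... | no _    | no _    | false = refl

  size : (V → Bool) → ℕ
  size P = ΣFin N (λ w → [ P w ])

  Σ-const : (P : V → Bool) (K : ℕ) → ΣFin N (λ w → if P w then K else 0) ≡ K * size P
  Σ-const P K = trans (Σ-cong N guarded≡scaled) (Σ-scale N K (λ w → [ P w ]))
    where
    guarded≡scaled : ∀ w → (if P w then K else 0) ≡ K * [ P w ]
    guarded≡scaled w with P w
    ... | true  = sym (*-identityʳ K)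
    ... | false = sym (*-zeroʳ K)

  degree-sum : (P : V → Bool) →
    ΣFin N (λ w → if P w then deg G w else 0) ≡ ΣFin M (λ e → [ P (ea e) ] + [ P (eb e) ])
  degree-sum P = begin
      ΣFin N (λ w → if P w then deg G w else 0)
    ≡⟨ Σ-cong N (λ w → Σ-if M (P w) _) ⟩
      ΣFin N (λ w → ΣFin M (λ e → if P w then [ incident? G e w ] else 0))
    ≡⟨ Σ-swap N M _ ⟩
      ΣFin M (λ e → ΣFin N (λ w → if P w then [ incident? G e w ] else 0))
    ≡⟨ Σ-cong M (λ e → trans (Σ-cong N (incidence-split P e)) (Σ-+ N _ _)) ⟩
      ΣFin M (λ e → ΣFin N (λ w → if ea e == w then [ P w ] else 0)
                  + ΣFin N (λ w → if eb e == w then [ P w ] else 0))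
    ≡⟨ Σ-cong M (λ e → cong₂ _+_ (Σ-select N (ea e) (λ w → [ P w ]))
                                 (Σ-select N (eb e) (λ w → [ P w ]))) ⟩
      ΣFin M (λ e → [ P (ea e) ] + [ P (eb e) ]) ∎
    where open ≡-Reasoning

  Pointer : V → Set
  Pointer y = Σ E λ e → Σ V λ z → Joins e y z

  Choice : Set
  Choice = (y : V) → Pointer y

  edge : Choice → V → E
  edge f y = proj₁ (f y)

  target : Choice → V → V
  target f y = proj₁ (proj₂ (f y))

  load : Choice → V → ℕ
  load f w = ΣFin N (λ y → [ target f y == w ])

  load-sum : (f : Choice) (R : V → Bool) →
    ΣFin N (λ w → if R w then load f w else 0) ≡ size (λ y → R (target f y))
  load-sum f R = begin
      ΣFin N (λ w → if R w then load f w else 0)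
    ≡⟨ Σ-cong N (λ w → Σ-if N (R w) _) ⟩
      ΣFin N (λ w → ΣFin N (λ y → if R w then [ target f y == w ] else 0))
    ≡⟨ Σ-swap N N _ ⟩
      ΣFin N (λ y → ΣFin N (λ w → if R w then [ target f y == w ] else 0))
    ≡⟨ Σ-cong N (λ y → trans (Σ-cong N (λ w → if-swap (R w) (target f y == w)))
                             (Σ-select N (target f y) (λ w → [ R w ]))) ⟩
      size (λ y → R (target f y)) ∎
    where
    open ≡-Reasoning
    if-swap : (b d : Bool) → (if b then [ d ] else 0) ≡ (if d then [ b ] else 0)
    if-swap true  true  = refl
    if-swap true  false = refl
    if-swap false true  = refl
    if-swap false false = refl

  Closed : Choice → (V → Bool) → Set
  Closed f R = ∀ y z e → R (target f y) ≡ true → Joins e y z → R z ≡ true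

  -- Double counting on a closed set R: each vertex pointing into R has at least
  -- δ edge-ends, all of whose partners lie in R, and R has at most Δ·|R| edge-ends;
  -- hence δ · (load of R) ≤ Δ · |R|.
  closed-load-bound : (f : Choice) (R : V → Bool) → Closed f R →
    minDeg G * ΣFin N (λ w → if R w then load f w else 0) ≤ maxDeg G * size R
  closed-load-bound f R closed = begin
      δ * ΣFin N (λ w → if R w then load f w else 0) ≡⟨ cong (δ *_) (load-sum f R) ⟩
      δ * size Y                                     ≡⟨ sym (Σ-const Y δ) ⟩
      ΣFin N (λ y → if Y y then δ else 0)            ≤⟨ Σ-mono N (λ y → guard-mono (Y y) (minFin-lb N (deg G) y)) ⟩
      ΣFin N (λ y → if Y y then deg G y else 0)      ≡⟨ degree-sum Y ⟩
      ΣFin M (λ e → [ Y (ea e) ] + [ Y (eb e) ])      ≤⟨ Σ-mono M partners-in-R ⟩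
      ΣFin M (λ e → [ R (ea e) ] + [ R (eb e) ])      ≡⟨ sym (degree-sum R) ⟩
      ΣFin N (λ w → if R w then deg G w else 0)      ≤⟨ Σ-mono N (λ w → guard-mono (R w) (maxFin-ub N (deg G) w)) ⟩
      ΣFin N (λ w → if R w then Δ else 0)            ≡⟨ Σ-const R Δ ⟩
      Δ * size R                                     ∎
    where
    open ≤-Reasoning
    δ Δ : ℕ
    δ = minDeg G
    Δ = maxDeg G
    Y : V → Bool
    Y y = R (target f y)
    partners-in-R : ∀ e → [ Y (ea e) ] + [ Y (eb e) ] ≤ [ R (ea e) ] + [ R (eb e) ]
    partners-in-R e = ≤-trans (≤-reflexive (+-comm [ Y (ea e) ] _))
      (+-mono-≤ ([]-mono _ _ (λ Yb → closed (eb e) (ea e) e Yb (inj₂ (refl , refl))))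
                ([]-mono _ _ (λ Ya → closed (ea e) (eb e) e Ya (inj₁ (refl , refl)))))

  Step : Choice → V → V → Set
  Step f v w = Σ V λ y → target f y ≡ v × Σ E λ e → Joins e y w

  data Walk (f : Choice) (u : V) : V → ℕ → Set where
    here : Walk f u u 0
    _▸_  : ∀ {v w k} → Walk f u v k → Step f v w → Walk f u w (suc k)

  Reachable : Choice → V → (V → Bool) → Set
  Reachable f u R = ∀ z → R z ≡ true → ∃ (Walk f u z)

  joins? : ∀ e y z → Dec (Joins e y z)
  joins? e y z = ((ea e ≟ y) ×-dec (eb e ≟ z)) ⊎-dec ((ea e ≟ z) ×-dec (eb e ≟ y))

  Entered : Choice → (V → Bool) → V → Set
  Entered f R z = ∃ λ y → R (target f y) ≡ true × ∃ λ e → Joins e y z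

  entered? : ∀ f R z → Dec (Entered f R z)
  entered? f R z = any? (λ y → (R (target f y) Bool.≟ true) ×-dec any? (λ e → joins? e y z))

  Escape : Choice → (V → Bool) → Set
  Escape f R = ∃ λ z → Entered f R z × R z ≡ false

  escape? : ∀ f R → Dec (Escape f R)
  escape? f R = any? (λ z → entered? f R z ×-dec (R z Bool.≟ false))

  extend : Choice → (V → Bool) → V → Bool
  extend f R z = R z ∨ does (entered? f R z)

  extend-⊇ : ∀ f R z → R z ≡ true → extend f R z ≡ true
  extend-⊇ f R z Rz rewrite Rz = refl

  extend-sound : ∀ f R z → extend f R z ≡ true → R z ≡ true ⊎ Entered f R z
  extend-sound f R z ext with R z
  ... | true  = inj₁ refl
  ... | false = inj₂ (fromDoes (entered? f R z) ext)

  extend-reachable : ∀ f u R → Reachable f u R → Reachable f u (extend f R)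
  extend-reachable f u R reach z ext with extend-sound f R z ext
  ... | inj₁ Rz                = reach z Rz
  ... | inj₂ (y , Ry , e , j)  = let (k , W) = reach (target f y) Ry in suc k , (W ▸ (y , refl , e , j))

  extend-grows : ∀ f R → Escape f R → suc (size R) ≤ size (extend f R)
  extend-grows f R (z , ent , Rz≡false) =
    Σ-strict N (λ w → []-mono _ _ (extend-⊇ f R w)) z new
    where
    new : [ R z ] < [ extend f R z ]
    new rewrite Rz≡false | dec-true (entered? f R z) ent = s≤s z≤n

  no-escape-closed : ∀ f R → ¬ Escape f R → Closed f R
  no-escape-closed f R no-esc y z e Ry j with R z in Rz
  ... | true  = refl
  ... | false = ⊥-elim (no-esc (z , (y , Ry , e , j) , Rz))

  closure : Choice → ℕ → (V → Bool) → V → Bool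
  closure f zero    R = R
  closure f (suc k) R with escape? f R
  ... | yes _ = closure f k (extend f R)
  ... | no _  = R

  closure-⊇ : ∀ f k R z → R z ≡ true → closure f k R z ≡ true
  closure-⊇ f zero    R z Rz = Rz
  closure-⊇ f (suc k) R z Rz with escape? f R
  ... | yes _ = closure-⊇ f k (extend f R) z (extend-⊇ f R z Rz)
  ... | no _  = Rz

  closure-reachable : ∀ f u k R → Reachable f u R → Reachable f u (closure f k R)
  closure-reachable f u zero    R reach = reach
  closure-reachable f u (suc k) R reach with escape? f R
  ... | yes _ = closure-reachable f u k (extend f R) (extend-reachable f u R reach)
  ... | no _  = reach

  -- Each productive round adds a vertex, so enough rounds reach a closed set.
  closure-closed : ∀ f k R → N < size R + k → Closed f (closure f k R)
  closure-closed f zero R N<|R| =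
    ⊥-elim (<⇒≱ N<|R| (≤-trans (≤-reflexive (+-identityʳ _)) (Σ-count≤ N R)))
  closure-closed f (suc k) R N<|R|+k+1 with escape? f R
  ... | yes esc = closure-closed f k (extend f R)
                    (<-≤-trans N<|R|+k+1 (≤-trans (≤-reflexive (+-suc (size R) k))
                                                   (+-monoˡ-≤ k (extend-grows f R esc))))
  ... | no no-esc = no-escape-closed f R no-esc

  redirect : Choice → (y : V) → Pointer y → Choice
  redirect f y p y' with y' ≟ y
  ... | yes refl = p
  ... | no _     = f y'

  redirect-other : ∀ f y p y' → y' ≢ y → redirect f y p y' ≡ f y'
  redirect-other f y p y' y'≢y with y' ≟ y
  ... | yes refl = ⊥-elim (y'≢y refl)
  ... | no _     = refl

  redirect-target : ∀ f y p → target (redirect f y p) y ≡ proj₁ (proj₂ p)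
  redirect-target f y p with y ≟ y
  ... | yes refl = refl
  ... | no y≢y   = ⊥-elim (y≢y refl)

  load-redirect : ∀ f y p w →
    load (redirect f y p) w + [ target f y == w ] ≡ load f w + [ proj₁ (proj₂ p) == w ]
  load-redirect f y p w = trans
    (Σ-update N (λ y' → [ target f y' == w ]) (λ y' → [ target (redirect f y p) y' == w ]) y
       (λ y' y'≢y → cong (λ q → [ proj₁ (proj₂ q) == w ]) (redirect-other f y p y' y'≢y)))
    (cong (λ v → load f w + [ v == w ]) (redirect-target f y p))

  module Redirect (f : Choice) (y : V) (p : Pointer y)
                  (s≢t : target f y ≢ proj₁ (proj₂ p)) where
    f' : Choice
    f' = redirect f y p

    s t : V
    s = target f y
    t = proj₁ (proj₂ p)

    at-source : suc (load f' s) ≡ load f s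
    at-source = begin
      suc (load f' s)          ≡⟨ +-comm 1 (load f' s) ⟩
      load f' s + 1            ≡⟨ cong (λ b → load f' s + [ b ]) (sym (==-refl s)) ⟩
      load f' s + [ s == s ]   ≡⟨ load-redirect f y p s ⟩
      load f s + [ t == s ]    ≡⟨ cong (λ b → load f s + [ b ]) (dec-false (t ≟ s) (λ t≡s → s≢t (sym t≡s))) ⟩
      load f s + 0             ≡⟨ +-identityʳ (load f s) ⟩
      load f s                 ∎
      where open ≡-Reasoning

    at-target : load f' t ≡ suc (load f t)
    at-target = begin
      load f' t                ≡⟨ sym (+-identityʳ (load f' t)) ⟩
      load f' t + 0            ≡⟨ cong (λ b → load f' t + [ b ]) (sym (dec-false (s ≟ t) s≢t)) ⟩
      load f' t + [ s == t ]   ≡⟨ load-redirect f y p t ⟩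
      load f t + [ t == t ]    ≡⟨ cong (λ b → load f t + [ b ]) (==-refl t) ⟩
      load f t + 1             ≡⟨ +-comm (load f t) 1 ⟩
      suc (load f t)           ∎
      where open ≡-Reasoning

    elsewhere : ∀ w → w ≢ s → w ≢ t → load f' w ≡ load f w
    elsewhere w w≢s w≢t = +-cancelʳ-≡ 0 (load f' w) (load f w) (begin
      load f' w + 0            ≡⟨ cong (λ b → load f' w + [ b ]) (sym (dec-false (s ≟ w) (λ s≡w → w≢s (sym s≡w)))) ⟩
      load f' w + [ s == w ]   ≡⟨ load-redirect f y p w ⟩
      load f w + [ t == w ]    ≡⟨ cong (λ b → load f w + [ b ]) (dec-false (t ≟ w) (λ t≡w → w≢t (sym t≡w))) ⟩
      load f w + 0             ∎)
      where open ≡-Reasoning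

  chosen : Choice → SpanningSubgraph G
  chosen f e = does (any? (λ y → edge f y ≟ e))

  chosen-sound : ∀ f e → chosen f e ≡ true → ∃ λ y → edge f y ≡ e
  chosen-sound f e = fromDoes (any? (λ y → edge f y ≟ e))

  chosen-complete : ∀ f y → chosen f (edge f y) ≡ true
  chosen-complete f y = dec-true (any? (λ y' → edge f y' ≟ edge f y)) (y , refl)

  chosen-incident : ∀ f y → incident? G (edge f y) y ≡ true
  chosen-incident f y with proj₂ (proj₂ (f y))
  ... | inj₁ (a≡y , _) = incident-complete (edge f y) y (inj₁ a≡y)
  ... | inj₂ (_ , b≡y) = incident-complete (edge f y) y (inj₂ b≡y)

  joins-endpoint : ∀ {e y z} x → Joins e y z → ea e ≡ x ⊎ eb e ≡ x → 1 ≤ [ y == x ] + [ z == x ]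
  joins-endpoint {e} {y} {z} x j end = count (same-vertex j end)
    where
    same-vertex : Joins e y z → ea e ≡ x ⊎ eb e ≡ x → y ≡ x ⊎ z ≡ x
    same-vertex (inj₁ (a≡y , b≡z)) (inj₁ a≡x) = inj₁ (trans (sym a≡y) a≡x)
    same-vertex (inj₁ (a≡y , b≡z)) (inj₂ b≡x) = inj₂ (trans (sym b≡z) b≡x)
    same-vertex (inj₂ (a≡z , b≡y)) (inj₁ a≡x) = inj₂ (trans (sym a≡z) a≡x)
    same-vertex (inj₂ (a≡z , b≡y)) (inj₂ b≡x) = inj₁ (trans (sym b≡y) b≡x)
    count : y ≡ x ⊎ z ≡ x → 1 ≤ [ y == x ] + [ z == x ]
    count (inj₁ refl) rewrite ==-refl y = s≤s z≤n
    count (inj₂ refl) rewrite ==-refl z = m≤n+m 1 [ y == z ]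

  -- Each vertex meets its own chosen edge ...
  chosen-degree-pos : ∀ f x → 1 ≤ degIn G (chosen f) x
  chosen-degree-pos f x = ≤-trans own-edge (Σ-term M _ (edge f x))
    where
    own-edge : 1 ≤ (if chosen f (edge f x) then [ incident? G (edge f x) x ] else 0)
    own-edge rewrite chosen-complete f x | chosen-incident f x = ≤-refl

  -- ... and otherwise only the chosen edges of the vertices pointing at it.
  chosen-degree-bound : ∀ f x → degIn G (chosen f) x ≤ suc (load f x)
  chosen-degree-bound f x = begin
      degIn G (chosen f) x
    ≤⟨ Σ-mono M charge ⟩
      ΣFin M (λ e → ΣFin N (λ y → if edge f y == e then K y else 0))
    ≡⟨ Σ-swap M N _ ⟩
      ΣFin N (λ y → ΣFin M (λ e → if edge f y == e then K y else 0))
    ≡⟨ Σ-cong N (λ y → Σ-select M (edge f y) (λ _ → K y)) ⟩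
      ΣFin N K
    ≡⟨ Σ-+ N _ _ ⟩
      ΣFin N (λ y → [ y == x ]) + load f x
    ≡⟨ cong (_+ load f x) (trans (Σ-cong N (λ y → cong [_] (==-sym y x))) (Σ-select N x (λ _ → 1))) ⟩
      suc (load f x) ∎
    where
    open ≤-Reasoning
    -- the edge chosen by y meets x at most K y times
    K : V → ℕ
    K y = [ y == x ] + [ target f y == x ]
    -- charge each chosen edge at x to a vertex that chose it
    charge : ∀ e → (if chosen f e then [ incident? G e x ] else 0)
                   ≤ ΣFin N (λ y → if edge f y == e then K y else 0)
    charge e with chosen f e in is-chosen | incident? G e x in inc
    ... | false | _     = z≤n
    ... | true  | false = z≤n
    ... | true  | true with chosen-sound f e is-chosen
    ...   | y , refl = ≤-trans chooser (Σ-term N (λ y' → if edge f y' == e then K y' else 0) y)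
      where
      chooser : 1 ≤ (if edge f y == edge f y then K y else 0)
      chooser rewrite ==-refl (edge f y) =
        joins-endpoint x (proj₂ (proj₂ (f y))) (incident-sound (edge f y) x inc)

  initial-choice : NoIsolatedVertices G → Choice
  initial-choice no-iso y = along (proj₁ edge-at-y) (incident-sound _ y (positive (proj₂ edge-at-y)))
    where
    edge-at-y : ∃ λ e → 0 < [ incident? G e y ]
    edge-at-y = Σ-pos M _ (no-iso y)
    positive : ∀ {b} → 0 < [ b ] → b ≡ true
    positive {true} _ = refl
    along : ∀ e → ea e ≡ y ⊎ eb e ≡ y → Pointer y
    along e (inj₁ a≡y) = e , eb e , inj₁ (a≡y , refl)
    along e (inj₂ b≡y) = e , ea e , inj₂ (refl , b≡y)

  capacity : ℕ
  capacity = maxDeg G ∸ minDeg G + 1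

  -- The capacity is large enough: a closed set containing a vertex of load > c
  -- contains a vertex of load < c, since otherwise its load would exceed the
  -- bound of closed-load-bound.

  underloaded-in-closed : NoIsolatedVertices G → ∀ f R u → Closed f R → R u ≡ true →
    capacity < load f u → ∃ λ z → R z ≡ true × load f z < capacity
  underloaded-in-closed no-iso f R u closed Ru overloaded
    with any? (λ z → (R z Bool.≟ true) ×-dec (load f z <? capacity))
  ... | yes found = found
  ... | no none   = ⊥-elim (<⇒≱ (capacity-bound δ Δ (size R) 1≤δ δ≤Δ) too-much)
    where
    δ Δ : ℕ
    δ = minDeg G
    Δ = maxDeg G
    1≤δ : 1 ≤ δ
    1≤δ = minFin-glb N (deg G) 1 u no-iso
    δ≤Δ : δ ≤ Δ
    δ≤Δ = ≤-trans (minFin-lb N (deg G) u) (maxFin-ub N (deg G) u)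
    at-least : ∀ w → (if R w then capacity else 0) + [ u == w ] ≤ (if R w then load f w else 0)
    at-least w with u ≟ w
    ... | yes refl rewrite Ru = ≤-trans (≤-reflexive (+-comm capacity 1)) overloaded
    ... | no _ with R w in Rw
    ...   | true  = ≤-trans (≤-reflexive (+-identityʳ capacity))
                            (≮⇒≥ (λ w-under → none (w , Rw , w-under)))
    ...   | false = z≤n
    total-load : capacity * size R + 1 ≤ ΣFin N (λ w → if R w then load f w else 0)
    total-load = begin
      capacity * size R + 1
        ≡⟨ cong₂ _+_ (sym (Σ-const R capacity)) (sym (Σ-select N u (λ _ → 1))) ⟩
      ΣFin N (λ w → if R w then capacity else 0) + ΣFin N (λ w → [ u == w ])
        ≡⟨ sym (Σ-+ N _ _) ⟩
      ΣFin N (λ w → (if R w then capacity else 0) + [ u == w ])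
        ≤⟨ Σ-mono N at-least ⟩
      ΣFin N (λ w → if R w then load f w else 0) ∎
      where open ≤-Reasoning
    too-much : δ * (capacity * size R + 1) ≤ Δ * size R
    too-much = ≤-trans (*-monoʳ-≤ δ total-load) (closed-load-bound f R closed)

module Balancing (G : Graph) (c : ℕ) where
  open Choices G

  excess : Choice → ℕ
  excess f = ΣFin N (λ w → load f w ∸ c)

  module RedirectExcess (f : Choice) (y : V) (p : Pointer y)
                        (s≢t : target f y ≢ proj₁ (proj₂ p)) where
    open Redirect f y p s≢t

    excess-pointwise : load f t < c → ∀ w → load f' w ∸ c ≤ load f w ∸ c
    excess-pointwise t<c w with w ≟ s | w ≟ t
    ... | yes refl | _        = ∸-monoˡ-≤ c (≤-trans (n≤1+n _) (≤-reflexive at-source))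
    ... | no _     | yes refl = ≤-trans (≤-reflexive (m≤n⇒m∸n≡0 (≤-trans (≤-reflexive at-target) t<c))) z≤n
    ... | no w≢s   | no w≢t   = ≤-reflexive (cong (_∸ c) (elsewhere w w≢s w≢t))

    excess-≤ : load f t < c → excess f' ≤ excess f
    excess-≤ t<c = Σ-mono N (excess-pointwise t<c)

    excess-< : load f t < c → c < load f s → excess f' < excess f
    excess-< t<c c<s = Σ-strict N (excess-pointwise t<c) s source-drops
      where
      source-drops : load f' s ∸ c < load f s ∸ c
      source-drops = begin-strict
        load f' s ∸ c          <⟨ n<1+n _ ⟩
        suc (load f' s ∸ c)    ≡⟨ sym (+-∸-assoc 1 (≤-pred (≤-trans c<s (≤-reflexive (sym at-source))))) ⟩
        suc (load f' s) ∸ c    ≡⟨ cong (_∸ c) at-source ⟩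
        load f s ∸ c           ∎
        where open ≤-Reasoning

  reroute : ∀ {f u w k} (y : V) (p : Pointer y) → Walk f u w k →
    (∃ λ j → j < k × Walk f u (target f y) j) ⊎ Walk (redirect f y p) u w k
  reroute y p here = inj₂ here
  reroute {f} {u} y p (_▸_ {v} {w} {k} W (y' , ty'≡v , e , j)) with v ≟ target f y
  ... | yes v≡s = inj₁ (k , n<1+n k , subst (λ x → Walk f u x k) v≡s W)
  ... | no v≢s with reroute y p W
  ...   | inj₁ (j' , j'<k , W') = inj₁ (j' , m≤n⇒m≤1+n j'<k , W')
  ...   | inj₂ W₁ = inj₂ (W₁ ▸ (y' , target-kept , e , j))
    where
    target-kept : target (redirect f y p) y' ≡ v
    target-kept = trans (cong (λ q → proj₁ (proj₂ q))
                              (redirect-other f y p y' (λ { refl → v≢s (sym ty'≡v) })))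
                        ty'≡v

  Improvable : ℕ → Set
  Improvable k = ∀ f u v → Walk f u v k → c < load f u → load f v < c →
                 ∃ λ f' → excess f' < excess f

  improve : ∀ k → Improvable k
  improve = <-rec Improvable push
    where
    push : ∀ k → (∀ {j} → j < k → Improvable j) → Improvable k
    push zero    rec f u .u here c<u u<c = ⊥-elim (<-asym c<u u<c)
    push (suc k) rec f u v (_▸_ {s} W (y , ty≡s , e , j)) c<u v<c with <-cmp (load f s) c
    -- s is overloaded: redirect y from s to v.
    ... | tri> _ _ c<s =
      redirect f y p , RedirectExcess.excess-< f y p s≢v v<c (subst (λ x → c < load f x) (sym ty≡s) c<s)
      where
      p : Pointer y
      p = e , v , j
      s≢v : target f y ≢ v
      s≢v ty≡v = <-asym c<s (subst (λ x → load f x < c) (trans (sym ty≡v) ty≡s) v<c)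
    -- s is underloaded: the shorter walk to s already works.
    ... | tri< s<c _ _ = rec (n<1+n k) f u s W c<u s<c
    -- s is exactly full: redirect y, making s underloaded, and continue on the walk to s.
    ... | tri≈ _ s≡c _ with reroute y (e , v , j) W
    ...   | inj₁ (j' , j'<k , W') = rec (s≤s j'<k) f u v (W' ▸ (y , refl , e , j)) c<u v<c
    ...   | inj₂ W₁ =
      let (f'' , smaller) = rec (n<1+n k) f' u s W₁ c<u' s<c' in
      f'' , <-≤-trans smaller (RedirectExcess.excess-≤ f y p s≢v v<c)
      where
      p : Pointer y
      p = e , v , j
      s≢v : target f y ≢ v
      s≢v ty≡v = <-irrefl s≡c (subst (λ x → load f x < c) (trans (sym ty≡v) ty≡s) v<c)
      open Redirect f y p s≢v using (f' ; at-source ; elsewhere)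
      u≢s : u ≢ target f y
      u≢s u≡ty = <-irrefl (sym s≡c) (subst (λ x → c < load f x) (trans u≡ty ty≡s) c<u)
      u≢v : u ≢ v
      u≢v u≡v = <-asym c<u (subst (λ x → load f x < c) (sym u≡v) v<c)
      c<u' : c < load f' u
      c<u' = subst (c <_) (sym (elsewhere u u≢s u≢v)) c<u
      s<c' : load f' s < c
      s<c' = begin-strict
        load f' s                  <⟨ n<1+n _ ⟩
        suc (load f' s)            ≡⟨ cong (λ x → suc (load f' x)) (sym ty≡s) ⟩
        suc (load f' (target f y)) ≡⟨ at-source ⟩
        load f (target f y)        ≡⟨ cong (load f) ty≡s ⟩
        load f s                   ≡⟨ s≡c ⟩
        c                          ∎
        where open ≤-Reasoning

  -- The hypothesis that makes c a workable capacity.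
  UnderloadedInClosed : Set
  UnderloadedInClosed = ∀ f R u → Closed f R → R u ≡ true → c < load f u →
                        ∃ λ z → R z ≡ true × load f z < c

  -- A choice with positive excess has an overloaded vertex u; the closure of {u}
  -- is closed, so it contains an underloaded vertex, reached from u by a walk.
  improving-step : UnderloadedInClosed → ∀ f → 0 < excess f → ∃ λ f' → excess f' < excess f
  improving-step underloaded f positive =
    let (u , excess-at-u) = Σ-pos N (λ w → load f w ∸ c) positive
        c<u               = m∸n≢0⇒n<m (n>0⇒n≢0 excess-at-u)
        (z , Rz , z<c)    = underloaded f (closure f N (u ==_)) u
                              (closure-closed f N (u ==_) (enough-rounds u))
                              (closure-⊇ f N (u ==_) u (==-refl u)) c<u
        (k , W)           = closure-reachable f u N (u ==_) (start-reachable u) z Rz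
    in improve k f u z W c<u z<c
    where
    start-reachable : ∀ u → Reachable f u (u ==_)
    start-reachable u z u≡z = 0 , subst (λ x → Walk f u x 0) (fromDoes (u ≟ z) u≡z) here
    enough-rounds : ∀ u → N < size (u ==_) + N
    enough-rounds u rewrite Σ-select N u (λ _ → 1) = n<1+n N

  balanced-choice : UnderloadedInClosed → Choice → Σ Choice λ f → ∀ w → load f w ≤ c
  balanced-choice underloaded = descend (λ f → ∀ w → load f w ≤ c) excess step
    where
    step : ∀ f → (∀ w → load f w ≤ c) ⊎ Σ Choice (λ f' → excess f' < excess f)
    step f with excess f ≟ℕ 0
    ... | yes no-excess = inj₁ (λ w → m∸n≡0⇒m≤n (n≤0⇒n≡0
                            (≤-trans (Σ-term N (λ w → load f w ∸ c) w) (≤-reflexive no-excess))))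
    ... | no some-excess = inj₂ (improving-step underloaded f (n≢0⇒n>0 some-excess))

mainTheorem14 : (G : Graph) → NoIsolatedVertices G →
    SpAtMost G (maxDeg G ∸ minDeg G + 2)
mainTheorem14 G no-iso = chosen f , λ x → chosen-degree-pos f x , degree-bound x
  where
  open Choices G
  -- Choose a pointer at every vertex with all loads at most Δ - δ + 1 ...
  balanced : Σ Choice λ f → ∀ w → load f w ≤ capacity
  balanced = Balancing.balanced-choice G capacity (underloaded-in-closed no-iso) (initial-choice no-iso)
  f : Choice
  f = proj₁ balanced
  -- ... then the chosen edges meet every vertex at most (Δ - δ + 1) + 1 times.
  degree-bound : ∀ x → degIn G (chosen f) x ≤ maxDeg G ∸ minDeg G + 2
  degree-bound x = ≤-trans (chosen-degree-bound f x)
                           (≤-trans (s≤s (proj₂ balanced x)) (≤-reflexive (sym (+-suc _ 1))))
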